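{- Let $k\ge 2$, let $G$ be a graph with minimum degree at least $k$, and let $L=(P,C)$ be an optimal lollipop of $G$. Then $C$ contains at least $k+1$ vertices each having at least $k$ neighbors in $V(C)$. In particular, $C$ has at least $\frac{(k+1)(k-2)}{2}$ chords.
   Context: All graphs are finite and simple. A path is a sequence $p_1\dots p_s$ of distinct vertices with consecutive vertices adjacent; a cycle is a sequence $c_1\dots c_t c_1$ ($t\ge 3$) of distinct vertices with consecutive vertices (indices mod $t$) adjacent; its length is its number of edges. A chord of $C$ is an edge of $G$ between two vertices of $C$ that is not an edge of $C$. A lollipop in $G$ is a pair $L=(P,C)$ where $P=p_1\dots p_s$ ($s\geq 1$) is a path, $C=c_1\dots c_tc_1$ ($t\geq 3$) is a cycle, $p_s=c_1$ and $V(P)\cap V(C)=\{c_1\}$; $V(L)=V(P)\cup V(C)$. $L=(P,C)$ is optimal if no lollipop $L'$ satisfies $V(L)\subsetneq V(L')$, and no lollipop $L'=(P',C')$ with $V(L')=V(L)$ has $C'$ longer than $C$. -}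

module Defs where

open import Data.Nat using (ℕ; _≤_; _*_; _∸_; _+_)
open import Data.Fin using (Fin) renaming (_<_ to _<ᶠ_)
open import Data.List using (List; []; _∷_; _++_; [_]; length)
open import Data.List.Membership.Propositional using (_∈_)
open import Data.List.Relation.Unary.All using (All)
open import Data.List.Relation.Unary.Linked using (Linked)
open import Data.List.Relation.Unary.Unique.Propositional using (Unique)
open import Data.Product using (Σ; ∃; _×_; _,_)
open import Data.Sum using (_⊎_)
open import Relation.Nullary using (¬_)
open import Relation.Binary.PropositionalEquality using (_≡_; _≢_)

record Graph (n : ℕ) : Set₁ where
  field
    Adj    : Fin n → Fin n → Set
    sym    : ∀ {u v} → Adj u v → Adj v u
    irrefl : ∀ {u} → ¬ Adj u u
open Graph public

module _ {n : ℕ} (G : Graph n) where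

  AtLeastNbrs : ℕ → Fin n → Set
  AtLeastNbrs k v = ∃ λ (ws : List (Fin n)) →
    Unique ws × k ≤ length ws × All (Adj G v) ws

  AtLeastNbrsIn : ℕ → Fin n → List (Fin n) → Set
  AtLeastNbrsIn k v S = ∃ λ (ws : List (Fin n)) →
    Unique ws × k ≤ length ws × All (λ w → w ∈ S × Adj G v w) ws

  MinDegreeAtLeast : ℕ → Set
  MinDegreeAtLeast k = ∀ v → AtLeastNbrs k v

  IsPath : List (Fin n) → Set
  IsPath ps = ps ≢ [] × Unique ps × Linked (Adj G) ps

  IsCycle : Fin n → List (Fin n) → Set
  IsCycle c₁ tl = 3 ≤ length (c₁ ∷ tl) × Unique (c₁ ∷ tl)
                × Linked (Adj G) ((c₁ ∷ tl) ++ [ c₁ ])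

consecPairs : {A : Set} → List A → List (A × A)
consecPairs (x ∷ y ∷ xs) = (x , y) ∷ consecPairs (y ∷ xs)
consecPairs _ = []

CycleEdge : {n : ℕ} → Fin n → List (Fin n) → Fin n → Fin n → Set
CycleEdge c₁ tl u v =
  (u , v) ∈ consecPairs ((c₁ ∷ tl) ++ [ c₁ ]) ⊎ (v , u) ∈ consecPairs ((c₁ ∷ tl) ++ [ c₁ ])

record Lollipop {n : ℕ} (G : Graph n) : Set where
  field
    P     : List (Fin n)
    c₁    : Fin n
    Ctl   : List (Fin n)        -- C = c₁ c₂ … cₜ c₁ with vertex list c₁ ∷ Ctl
    pathP : IsPath G P
    cycC  : IsCycle G c₁ Ctl
    Pend  : ∃ λ pre → P ≡ pre ++ [ c₁ ]
    meet  : ∀ x → x ∈ P → x ∈ (c₁ ∷ Ctl) → x ≡ c₁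

  Cverts : List (Fin n)
  Cverts = c₁ ∷ Ctl

  -- length of C (number of edges = number of vertices t)
  cycLen : ℕ
  cycLen = length Cverts

  InV : Fin n → Set
  InV x = x ∈ P ⊎ x ∈ Cverts
open Lollipop public

module _ {n : ℕ} {G : Graph n} where

  Optimal : Lollipop G → Set
  Optimal L =
    (¬ (∃ λ (L' : Lollipop G) →
          (∀ x → InV L x → InV L' x) × (∃ λ x → InV L' x × ¬ InV L x)))
    × (∀ (L' : Lollipop G) → (∀ x → InV L x → InV L' x) → (∀ x → InV L' x → InV L x)
         → cycLen L' ≤ cycLen L)

  -- an (unordered, recorded with u < v) chord of the cycle of L
  IsChord : Lollipop G → Fin n × Fin n → Set
  IsChord L (u , v) = u <ᶠ v × u ∈ Cverts L × v ∈ Cverts L × Adj G u v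
                    × ¬ CycleEdge (c₁ L) (Ctl L) u v

-- Write L as a stick followed by its cycle C through c, and look at Hamiltonian paths of C starting at c. The end z
-- of such a path has all its neighbours on C: a neighbour on the stick closes a longer cycle on the same vertex set,
-- and a neighbour w outside L gives a larger lollipop, because the first vertex of the stick has a neighbour q beyond
-- the second vertex of the path "stick, then C", which closes a cycle and leaves a path from w through z back to q.
-- Pósa rotations at the k neighbours of one end give k distinct ends, all with k neighbours on C. If all of them are
-- adjacent to c, then c is one more such vertex; otherwise rotations at a non-neighbour of c keep the second vertex of
-- the path, and a final rotation at c supplies the extra vertex. Each of the k + 1 vertices has at least k − 2 chords,
-- and every chord is counted at most twice.

module Submission where

open import Defs hiding (sym)
open import Data.Fin using (Fin) renaming (_<_ to _<ᶠ_)
open import Data.Fin.Properties using (_≟_; <-cmp) renaming (_<?_ to _<ᶠ?_)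
open import Data.Nat using (ℕ; suc; s≤s⁻¹; _≤_; _+_; _*_; _∸_; z≤n; s≤s)
open import Data.Nat.Properties
  using (≤-refl; ≤-reflexive; ≤-trans; ≤-total; ≤⇒≯; n≤1+n; m≤n⇒m≤1+n; +-comm; +-suc; +-identityʳ; +-mono-≤; *-monoˡ-≤; ∸-monoˡ-≤)
open import Data.List using (List; []; _∷_; _++_; [_]; _∷ʳ_; length; reverse; take; filter; map)
open import Data.List.Properties
  using (length-map; length-++; ++-assoc; ++-conicalʳ; unfold-reverse; reverse-++; filter-all; ∷-injectiveˡ; ∷-injectiveʳ)
open import Data.List.Membership.Propositional using (_∈_; _∉_)
open import Data.List.Relation.Unary.Any using (here; there)
open import Data.List.Membership.Propositional.Properties using (∈-++⁻; ∈-++⁺ˡ; ∈-++⁺ʳ; ∈-∃++; ∈-filter⁻; ∈-map⁻)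
open import Data.List.Relation.Unary.All as All using (All; []; _∷_)
open import Data.List.Relation.Unary.All.Properties as All using ()
open import Data.List.Relation.Unary.Linked using (Linked; []; [-]; _∷_)
open import Data.List.Relation.Unary.Unique.Propositional using (Unique; []; _∷_)
open import Data.List.Relation.Binary.Disjoint.Propositional using (Disjoint)
open import Data.List.Relation.Binary.Permutation.Propositional using (_↭_; ↭-refl; ↭-sym; ↭-trans; ↭-prep; ↭⇒↭ₛ)
open import Data.List.Relation.Binary.Permutation.Propositional.Properties
  using (∈-resp-↭; ∷↭∷ʳ; ↭-length; ++⁺ˡ; ++⁺ʳ; ++-comm; shift; ↭-reverse)
import Data.List.Relation.Unary.Unique.Propositional.Properties as Unique
import Data.List.Relation.Binary.Permutation.Setoid.Properties as ↭ₛ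
open import Data.Product.Properties using (≡-dec)
open import Data.Product as Prod using (swap; Σ; ∃; ∃₂; _×_; _,_; proj₁; proj₂)
import Data.Sum
open import Data.Sum using (_⊎_; inj₁; inj₂; [_,_]′)
open import Data.Empty using (⊥; ⊥-elim)
open import Relation.Nullary using (¬_; Dec; yes; no)
open import Relation.Unary using (Decidable)
open import Relation.Unary.Properties using (∁?)
open import Function using (_∘_; case_of_)
open import Relation.Binary.Definitions using (tri<; tri≈; tri>; Symmetric; DecidableEquality)
open import Relation.Binary.PropositionalEquality using (_≡_; _≢_; refl; sym; trans; cong; subst; subst₂; setoid)

module _ {A : Set} where

  Unique-resp-↭ : {xs ys : List A} → xs ↭ ys → Unique xs → Unique ys
  Unique-resp-↭ p = ↭ₛ.Unique-resp-↭ (setoid A) (↭⇒↭ₛ p)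

  Unique-++⁻ˡ : ∀ xs {ys : List A} → Unique (xs ++ ys) → Unique xs
  Unique-++⁻ˡ []       _          = []
  Unique-++⁻ˡ (x ∷ xs) (x∉ ∷ xs!) = All.++⁻ˡ xs x∉ ∷ Unique-++⁻ˡ xs xs!

  Unique-++⁻ʳ : ∀ xs {ys : List A} → Unique (xs ++ ys) → Unique ys
  Unique-++⁻ʳ []       ys!      = ys!
  Unique-++⁻ʳ (x ∷ xs) (_ ∷ u) = Unique-++⁻ʳ xs u

  Unique-++⇒Disjoint : ∀ xs {ys : List A} → Unique (xs ++ ys) → Disjoint xs ys
  Unique-++⇒Disjoint (x ∷ xs) (x∉ ∷ _) (here refl , v∈ys) = All.lookup (All.++⁻ʳ xs x∉) v∈ys refl
  Unique-++⇒Disjoint (x ∷ xs) (_ ∷ u)  (there v∈xs , v∈ys) = Unique-++⇒Disjoint xs u (v∈xs , v∈ys)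

  take-++-∷ : ∀ xs {w : A} {ys zs} m → m ≤ length xs → take (suc m) (xs ++ w ∷ ys) ≡ take (suc m) (xs ++ w ∷ zs)
  take-++-∷ []       _       z≤n       = refl
  take-++-∷ (x ∷ xs) 0       _         = refl
  take-++-∷ (x ∷ xs) (suc m) (s≤s m≤) = cong (x ∷_) (take-++-∷ xs m m≤)

  ∷∷-view : ∀ {xs : List A} → 2 ≤ length xs → ∃₂ λ x y → ∃ λ ys → xs ≡ x ∷ y ∷ ys
  ∷∷-view {_ ∷ []}     (s≤s ())
  ∷∷-view {x ∷ y ∷ ys} _        = x , y , ys , refl

  length-≤-++ : ∀ xs {ys : List A} → length ys ≤ length (xs ++ ys)
  length-≤-++ []       = ≤-refl
  length-≤-++ (x ∷ xs) = m≤n⇒m≤1+n (length-≤-++ xs)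

  ∷-initLast : ∀ (x : A) xs → ∃₂ λ ys y → x ∷ xs ≡ ys ∷ʳ y
  ∷-initLast x []       = [] , x , refl
  ∷-initLast x (y ∷ xs) with ys , z , eq ← ∷-initLast y xs = x ∷ ys , z , cong (x ∷_) eq

  take-2-++-∷ : ∀ xs {w x : A} {ys zs} → take 1 (xs ++ w ∷ ys) ≡ [ x ] → w ≢ x →
                take 2 (xs ++ w ∷ zs) ≡ take 2 (xs ++ w ∷ ys)
  take-2-++-∷ []       refl w≢x = ⊥-elim (w≢x refl)
  take-2-++-∷ (a ∷ xs) _    _   = take-++-∷ (a ∷ xs) 1 (s≤s z≤n)

  take-1≡⇒∷ : ∀ {xs : List A} {x} → take 1 xs ≡ [ x ] → ∃ λ ys → xs ≡ x ∷ ys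
  take-1≡⇒∷ {y ∷ ys} refl = ys , refl

  take-2≡⇒∈consecPairs : ∀ {xs : List A} {x y} → take 2 xs ≡ x ∷ y ∷ [] → (x , y) ∈ consecPairs xs
  take-2≡⇒∈consecPairs {_ ∷ _ ∷ _} refl = here refl

  ∷-suffix-∷ʳ : ∀ xs {w : A} {ys s z} → xs ++ w ∷ ys ≡ s ∷ʳ z → ∃ λ ys′ → w ∷ ys ≡ ys′ ∷ʳ z
  ∷-suffix-∷ʳ []       {s = s}     eq = s , eq
  ∷-suffix-∷ʳ (x ∷ xs) {s = []}    eq with () ← ++-conicalʳ xs _ (∷-injectiveʳ eq)
  ∷-suffix-∷ʳ (x ∷ xs) {s = _ ∷ s} eq = ∷-suffix-∷ʳ xs (∷-injectiveʳ eq)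

  ∈-consecPairs⁻ : ∀ {a b : A} xs → (a , b) ∈ consecPairs xs → ∃₂ λ ys zs → xs ≡ ys ++ a ∷ b ∷ zs
  ∈-consecPairs⁻ (x ∷ y ∷ xs) (here refl) = [] , xs , refl
  ∈-consecPairs⁻ (x ∷ y ∷ xs) (there p) with ys , zs , eq ← ∈-consecPairs⁻ (y ∷ xs) p = x ∷ ys , zs , cong (x ∷_) eq

  ∈-consecPairs⁺ : ∀ {a z : A} xs → a ∈ xs ∷ʳ z → a ≢ z → ∃ λ b → (a , b) ∈ consecPairs (xs ∷ʳ z)
  ∈-consecPairs⁺ []           (here refl)         a≢z = ⊥-elim (a≢z refl)
  ∈-consecPairs⁺ (x ∷ [])     (here refl)         _   = _ , here refl
  ∈-consecPairs⁺ (x ∷ [])     (there (here refl)) a≢z = ⊥-elim (a≢z refl)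
  ∈-consecPairs⁺ (x ∷ y ∷ xs) (here refl)         _   = y , here refl
  ∈-consecPairs⁺ (x ∷ y ∷ xs) (there p)           a≢z = Prod.map₂ there (∈-consecPairs⁺ (y ∷ xs) p a≢z)

  consecPairs-fst∈ : ∀ {a b l : A} xs → (a , b) ∈ consecPairs (xs ∷ʳ l) → a ∈ xs
  consecPairs-fst∈ (x ∷ [])     (here refl) = here refl
  consecPairs-fst∈ (x ∷ y ∷ xs) (here refl) = here refl
  consecPairs-fst∈ (x ∷ y ∷ xs) (there p)   = there (consecPairs-fst∈ (y ∷ xs) p)

  consecPairs-snd∈ : ∀ {a b : A} x ys → (a , b) ∈ consecPairs (x ∷ ys) → b ∈ ys
  consecPairs-snd∈ x (y ∷ ys) (here refl) = here refl
  consecPairs-snd∈ x (y ∷ ys) (there p)   = there (consecPairs-snd∈ y ys p)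

  consecPairs-functionalʳ : ∀ {a b₁ b₂ l : A} xs → Unique xs →
    (a , b₁) ∈ consecPairs (xs ∷ʳ l) → (a , b₂) ∈ consecPairs (xs ∷ʳ l) → b₁ ≡ b₂
  consecPairs-functionalʳ (x ∷ [])     _          (here refl) (here refl) = refl
  consecPairs-functionalʳ (x ∷ y ∷ xs) _          (here refl) (here refl) = refl
  consecPairs-functionalʳ (x ∷ y ∷ xs) (x∉ ∷ _)   (here refl) (there p)   = ⊥-elim (All.lookup x∉ (consecPairs-fst∈ _ p) refl)
  consecPairs-functionalʳ (x ∷ y ∷ xs) (x∉ ∷ _)   (there p)   (here refl) = ⊥-elim (All.lookup x∉ (consecPairs-fst∈ _ p) refl)
  consecPairs-functionalʳ (x ∷ y ∷ xs) (_ ∷ xs!)  (there p)   (there q)   = consecPairs-functionalʳ (y ∷ xs) xs! p q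

  consecPairs-functionalˡ : ∀ {a₁ a₂ b : A} x ys → Unique ys →
    (a₁ , b) ∈ consecPairs (x ∷ ys) → (a₂ , b) ∈ consecPairs (x ∷ ys) → a₁ ≡ a₂
  consecPairs-functionalˡ x (y ∷ ys) _         (here refl) (here refl) = refl
  consecPairs-functionalˡ x (y ∷ ys) (y∉ ∷ _)  (here refl) (there p)   = ⊥-elim (All.lookup y∉ (consecPairs-snd∈ y ys p) refl)
  consecPairs-functionalˡ x (y ∷ ys) (y∉ ∷ _)  (there p)   (here refl) = ⊥-elim (All.lookup y∉ (consecPairs-snd∈ y ys p) refl)
  consecPairs-functionalˡ x (y ∷ ys) (_ ∷ ys!) (there p)   (there q)   = consecPairs-functionalˡ y ys ys! p q

module _ {A : Set} {P : A → Set} (P? : Decidable P) where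

  length-filter+filter-∁ : ∀ xs → length (filter P? xs) + length (filter (∁? P?) xs) ≡ length xs
  length-filter+filter-∁ []       = refl
  length-filter+filter-∁ (x ∷ xs) with P? x
  ... | yes _ = cong suc (length-filter+filter-∁ xs)
  ... | no  _ = trans (+-suc _ _) (cong suc (length-filter+filter-∁ xs))

  length≤1+length-filter-∁ : ∀ {xs} → Unique xs → (∀ {a b} → P a → P b → a ≡ b) →
                              length xs ≤ suc (length (filter (∁? P?) xs))
  length≤1+length-filter-∁ {[]}     _          _   = z≤n
  length≤1+length-filter-∁ {x ∷ xs} (x∉ ∷ xs!) one with P? x
  ... | yes px = s≤s (≤-reflexive (sym (cong length (filter-all (∁? P?) (All.map (λ x≢y py → x≢y (one px py)) x∉)))))
  ... | no  _  = s≤s (length≤1+length-filter-∁ xs! one)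

All-⊎ʳ : ∀ {A : Set} {P : A → Set} {Q : Set} {xs} → All (λ x → P x ⊎ Q) xs → All P xs ⊎ Q
All-⊎ʳ []             = inj₁ []
All-⊎ʳ (inj₂ q  ∷ _)  = inj₂ q
All-⊎ʳ (inj₁ px ∷ pxs) = Data.Sum.map₁ (px ∷_) (All-⊎ʳ pxs)

module _ {A B : Set} (R : A → B → Set) where

  injective-image : ∀ {xs} → Unique xs → (∀ {x} → x ∈ xs → ∃ (R x)) →
                    (∀ {x₁ x₂ y} → x₁ ∈ xs → x₂ ∈ xs → R x₁ y → R x₂ y → x₁ ≡ x₂) →
                    ∃ λ ys → Unique ys × length ys ≡ length xs × All (λ y → ∃ λ x → x ∈ xs × R x y) ys
  injective-image {[]}     _          _     _   = [] , [] , refl , []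
  injective-image {x ∷ xs} (x∉ ∷ xs!) image inj
    with ys , ys! , len , pre ← injective-image xs! (image ∘ there) (λ p q → inj (there p) (there q))
       | y , Rxy ← image (here refl)
    = y ∷ ys , All.tabulate y∉ys ∷ ys! , cong suc len , (x , here refl , Rxy) ∷ All.map (Prod.map₂ (Prod.map₁ there)) pre
    where
    y∉ys : ∀ {y′} → y′ ∈ ys → y ≢ y′
    y∉ys y′∈ refl with x′ , x′∈ , Rx′y ← All.lookup pre y′∈ =
      All.lookup x∉ x′∈ (inj (here refl) (there x′∈) Rxy Rx′y)

other-than : ∀ {A : Set} → DecidableEquality A → ∀ {xs : List A} → Unique xs → 2 ≤ length xs →
             (y : A) → ∃ λ x → x ∈ xs × x ≢ y
other-than _≟_ {_ ∷ []}    _                (s≤s ()) _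
other-than _≟_ {a ∷ b ∷ _} ((a≢b ∷ _) ∷ _) _        y with a ≟ y
... | no  a≢y  = a , here refl , a≢y
... | yes refl = b , there (here refl) , λ { refl → a≢b refl }

module _ {A : Set} {R : A → A → Set} where

  Linked-++⁻ˡ : ∀ xs {ys : List A} → Linked R (xs ++ ys) → Linked R xs
  Linked-++⁻ˡ []           _       = []
  Linked-++⁻ˡ (x ∷ [])     _       = [-]
  Linked-++⁻ˡ (x ∷ y ∷ xs) (r ∷ l) = r ∷ Linked-++⁻ˡ (y ∷ xs) l

  Linked-++⁻ʳ : ∀ xs {ys : List A} → Linked R (xs ++ ys) → Linked R ys
  Linked-++⁻ʳ []       l       = l
  Linked-++⁻ʳ (x ∷ []) [-]     = []
  Linked-++⁻ʳ (x ∷ []) (_ ∷ l) = l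
  Linked-++⁻ʳ (x ∷ y ∷ xs) (_ ∷ l) = Linked-++⁻ʳ (y ∷ xs) l

  Linked-join : ∀ xs {y} {ys : List A} → Linked R (xs ∷ʳ y) → Linked R (y ∷ ys) → Linked R (xs ++ y ∷ ys)
  Linked-join []           _       l = l
  Linked-join (x ∷ [])     (r ∷ _) l = r ∷ l
  Linked-join (x ∷ x′ ∷ xs) (r ∷ l₁) l = r ∷ Linked-join (x′ ∷ xs) l₁ l

  Linked-++-∷⁻ˡ : ∀ xs {y} {ys : List A} → Linked R (xs ++ y ∷ ys) → Linked R (xs ∷ʳ y)
  Linked-++-∷⁻ˡ xs {y} {ys} l = Linked-++⁻ˡ (xs ∷ʳ y) (subst (Linked R) (sym (++-assoc xs [ y ] ys)) l)

  Linked-∷ʳ⁻ : ∀ xs {y z : A} → Linked R (xs ∷ʳ y ∷ʳ z) → R y z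
  Linked-∷ʳ⁻ xs {y} {z} l with r ∷ [-] ← Linked-++⁻ʳ xs (subst (Linked R) (++-assoc xs [ y ] [ z ]) l) = r

  Linked-∷ʳ : ∀ {xs ys} {y z : A} → Linked R xs → xs ≡ ys ∷ʳ y → R y z → Linked R (xs ∷ʳ z)
  Linked-∷ʳ {ys = ys} {y} {z} l refl r = subst (Linked R) (sym (++-assoc ys [ y ] [ z ])) (Linked-join ys l (r ∷ [-]))

  module _ (R-sym : Symmetric R) where

    Linked-reverse : ∀ {xs : List A} → Linked R xs → Linked R (reverse xs)
    Linked-reverse []  = []
    Linked-reverse [-] = [-]
    Linked-reverse {x ∷ y ∷ xs} (r ∷ l) =
      subst (Linked R) (sym (unfold-reverse x (y ∷ xs))) (Linked-∷ʳ (Linked-reverse l) (unfold-reverse y xs) (R-sym r))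

    Linked-∷-reverse : ∀ {w} xs {z : A} → Linked R (xs ∷ʳ z) → R w z → Linked R (w ∷ reverse (xs ∷ʳ z))
    Linked-∷-reverse {w} xs {z} l r = subst (λ zs → Linked R (w ∷ zs)) (sym (reverse-++ xs [ z ]))
      (r ∷ subst (Linked R) (reverse-++ xs [ z ]) (Linked-reverse l))

    Linked-rotate : ∀ xs {w} ys {z : A} → Linked R (xs ++ w ∷ ys ∷ʳ z) → R w z → Linked R (xs ++ w ∷ reverse (ys ∷ʳ z))
    Linked-rotate xs ys l r = Linked-join xs (Linked-++-∷⁻ˡ xs l)
      (Linked-∷-reverse ys (Linked-++⁻ʳ (xs ∷ʳ _) (subst (Linked R) (sym (++-assoc xs [ _ ] _)) l)) r)

module Lollipops {n : ℕ} (G : Graph n) where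

  open import Data.List.Membership.DecPropositional (_≟_ {n}) using (_∈?_)

  Adj-sym : Symmetric (Adj G)
  Adj-sym = Graph.sym G

  record FlatLollipop : Set where
    field
      stick        : List (Fin n)
      root         : Fin n
      loop         : List (Fin n)
      distinct     : Unique (stick ++ root ∷ loop)
      stick-linked : Linked (Adj G) (stick ∷ʳ root)
      loop-linked  : Linked (Adj G) (root ∷ loop ∷ʳ root)
      loop-long    : 2 ≤ length loop

    vertices : List (Fin n)
    vertices = stick ++ root ∷ loop

  module _ (S : FlatLollipop) where
    open FlatLollipop S

    toLollipop : Lollipop G
    toLollipop = record
      { P     = stick ∷ʳ root
      ; c₁    = root
      ; Ctl   = loop
      ; pathP = (λ eq → case ++-conicalʳ stick _ eq of λ ())
              , Unique-++⁻ˡ (stick ∷ʳ root) (subst Unique (sym (++-assoc stick _ loop)) distinct)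
              , stick-linked
      ; cycC  = s≤s loop-long , Unique-++⁻ʳ stick distinct , loop-linked
      ; Pend  = stick , refl
      ; meet  = stick-meets-loop
      }
      where
      stick-meets-loop : ∀ x → x ∈ stick ∷ʳ root → x ∈ root ∷ loop → x ≡ root
      stick-meets-loop x x∈P x∈C with ∈-++⁻ stick x∈P
      ... | inj₁ x∈stick    = ⊥-elim (Unique-++⇒Disjoint stick distinct (x∈stick , x∈C))
      ... | inj₂ (here x≡r) = x≡r

    ∈vertices⇒InV : ∀ {x} → x ∈ vertices → InV toLollipop x
    ∈vertices⇒InV x∈ with ∈-++⁻ stick x∈
    ... | inj₁ x∈stick = inj₁ (∈-++⁺ˡ x∈stick)
    ... | inj₂ x∈C     = inj₂ x∈C

    InV⇒∈vertices : ∀ {x} → InV toLollipop x → x ∈ vertices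
    InV⇒∈vertices (inj₁ x∈P) with ∈-++⁻ stick x∈P
    ... | inj₁ x∈stick     = ∈-++⁺ˡ x∈stick
    ... | inj₂ (here refl) = ∈-++⁺ʳ stick (here refl)
    InV⇒∈vertices (inj₂ x∈C) = ∈-++⁺ʳ stick x∈C

  open FlatLollipop using (vertices; loop)

  module OptimalLollipop (L : Lollipop G) (opt : Optimal L) where

    c : Fin n
    c = c₁ L

    C : List (Fin n)
    C = Cverts L

    stick : List (Fin n)
    stick = proj₁ (Pend L)

    VL : List (Fin n)
    VL = stick ++ C

    stick-linked : Linked (Adj G) (stick ∷ʳ c)
    stick-linked = subst (Linked (Adj G)) (proj₂ (Pend L)) (proj₂ (proj₂ (pathP L)))

    cycle-linked : Linked (Adj G) (C ∷ʳ c)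
    cycle-linked = proj₂ (proj₂ (cycC L))

    C-unique : Unique C
    C-unique = proj₁ (proj₂ (cycC L))

    C-long : 3 ≤ length C
    C-long = proj₁ (cycC L)

    VL-unique : Unique VL
    VL-unique = Unique.++⁺ (Unique-++⁻ˡ stick P-unique) C-unique λ (x∈stick , x∈C) →
      Unique-++⇒Disjoint stick P-unique (x∈stick , here (meet L _ (P∋ x∈stick) x∈C))
      where
      P-unique : Unique (stick ∷ʳ c)
      P-unique = subst Unique (proj₂ (Pend L)) (proj₁ (proj₂ (pathP L)))
      P∋ : ∀ {x} → x ∈ stick → x ∈ P L
      P∋ x∈ = subst (_ ∈_) (sym (proj₂ (Pend L))) (∈-++⁺ˡ x∈)

    InV⇒∈VL : ∀ {x} → InV L x → x ∈ VL
    InV⇒∈VL {x} (inj₁ x∈P) with ∈-++⁻ stick (subst (x ∈_) (proj₂ (Pend L)) x∈P)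
    ... | inj₁ x∈stick     = ∈-++⁺ˡ x∈stick
    ... | inj₂ (here refl) = ∈-++⁺ʳ stick (here refl)
    InV⇒∈VL (inj₂ x∈C) = ∈-++⁺ʳ stick x∈C

    ∈VL⇒InV : ∀ {x} → x ∈ VL → InV L x
    ∈VL⇒InV {x} x∈ with ∈-++⁻ stick x∈
    ... | inj₁ x∈stick = inj₁ (subst (x ∈_) (sym (proj₂ (Pend L))) (∈-++⁺ˡ x∈stick))
    ... | inj₂ x∈C     = inj₂ x∈C

    no-extension : ∀ S {w} → vertices S ↭ w ∷ VL → ⊥
    no-extension S {w} S↭ = proj₁ opt (toLollipop S , L⊆S , w , ∈vertices⇒InV S w∈S , w∉L)
      where
      L⊆S : ∀ x → InV L x → InV (toLollipop S) x
      L⊆S x x∈L = ∈vertices⇒InV S (∈-resp-↭ (↭-sym S↭) (there (InV⇒∈VL x∈L)))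
      w∈S : w ∈ vertices S
      w∈S = ∈-resp-↭ (↭-sym S↭) (here refl)
      w∉L : ¬ InV L w
      w∉L w∈L with w∉VL ∷ _ ← Unique-resp-↭ S↭ (FlatLollipop.distinct S) = All.lookup w∉VL (InV⇒∈VL w∈L) refl

    no-longer : ∀ S → vertices S ↭ VL → length (loop S) ≤ length (Ctl L)
    no-longer S S↭ = s≤s⁻¹ (proj₂ opt (toLollipop S) L⊆S S⊆L)
      where
      L⊆S : ∀ x → InV L x → InV (toLollipop S) x
      L⊆S x x∈L = ∈vertices⇒InV S (∈-resp-↭ (↭-sym S↭) (InV⇒∈VL x∈L))
      S⊆L : ∀ x → InV (toLollipop S) x → InV L x
      S⊆L x x∈S = ∈VL⇒InV (∈-resp-↭ S↭ (InV⇒∈vertices S x∈S))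

    record HamPath : Set where
      field
        walk   : List (Fin n)
        starts : take 1 walk ≡ [ c ]
        spans  : walk ↭ C
        linked : Linked (Adj G) walk

    open HamPath

    EndsAt : HamPath → Fin n → Set
    EndsAt h z = ∃ λ s → walk h ≡ s ∷ʳ z

    Endpoint : Fin n → Set
    Endpoint z = Σ HamPath λ h → EndsAt h z

    C≤length-++-walk : ∀ xs h → length C ≤ length (xs ++ walk h)
    C≤length-++-walk xs h = subst (_≤ length (xs ++ walk h)) (↭-length (spans h)) (length-≤-++ xs)

    2≤length-++-walk : ∀ xs h → 2 ≤ length (xs ++ walk h)
    2≤length-++-walk xs h = ≤-trans (n≤1+n 2) (≤-trans C-long (C≤length-++-walk xs h))

    walk≡c∷ : ∀ h → ∃ λ t → walk h ≡ c ∷ t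
    walk≡c∷ h = take-1≡⇒∷ (starts h)

    walk-unique : ∀ h → Unique (walk h)
    walk-unique h = Unique-resp-↭ (↭-sym (spans h)) C-unique

    predecessor-unique : ∀ h {w₁ w₂ f} → (w₁ , f) ∈ consecPairs (walk h) → (w₂ , f) ∈ consecPairs (walk h) → w₁ ≡ w₂
    predecessor-unique h p q with t , walk≡ ← walk≡c∷ h with _ ∷ t! ← subst Unique walk≡ (walk-unique h) =
      consecPairs-functionalˡ c t t! (subst (_ ∈_) (cong consecPairs walk≡) p) (subst (_ ∈_) (cong consecPairs walk≡) q)

    successor≢c : ∀ h {w f} → (w , f) ∈ consecPairs (walk h) → f ≢ c
    successor≢c h wf refl with t , walk≡ ← walk≡c∷ h with c∉t ∷ _ ← subst Unique walk≡ (walk-unique h) =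
      All.lookup c∉t (consecPairs-snd∈ c t (subst (_ ∈_) (cong consecPairs walk≡) wf)) refl

    walk≡c∷r∷ : ∀ h → ∃₂ λ r t → walk h ≡ c ∷ r ∷ t
    walk≡c∷r∷ h with x , r , t , walk≡ ← ∷∷-view (2≤length-++-walk [] h)
      = r , t , trans walk≡ (cong (λ y → y ∷ r ∷ t) (∷-injectiveˡ (trans (cong (take 1) (sym walk≡)) (starts h))))

    stick++walk-linked : ∀ h → Linked (Adj G) (stick ++ walk h)
    stick++walk-linked h with t , walk≡ ← walk≡c∷ h =
      subst (λ ws → Linked (Adj G) (stick ++ ws)) (sym walk≡) (Linked-join stick stick-linked (subst (Linked (Adj G)) walk≡ (linked h)))

    stick++walk-starts : ∀ h {p ps} → stick ++ walk h ≡ p ∷ ps → ∃ λ ps′ → stick ∷ʳ c ≡ p ∷ ps′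
    stick++walk-starts h Q≡ with t , walk≡ ← walk≡c∷ h =
      take-1≡⇒∷ (trans (take-++-∷ stick 0 z≤n) (cong (take 1) (trans (cong (stick ++_) (sym walk≡)) Q≡)))

    -- Closing the cycle through a neighbour w on the stick yields the same vertex set with a longer cycle.
    endpoint-nbr∉stick : ∀ h {z w} → EndsAt h z → Adj G z w → w ∉ stick
    endpoint-nbr∉stick h {z} {w} (s , ends) z~w w∈stick with ∈-∃++ w∈stick
    ... | X , Y , stick≡ = ≤⇒≯ (no-longer S S↭VL) (C≤length-++-walk Y h)
      where
      Xw-linked : Linked (Adj G) (X ++ w ∷ Y ∷ʳ c)
      Xw-linked = subst (Linked (Adj G)) (trans (cong (_∷ʳ c) stick≡) (++-assoc X (w ∷ Y) [ c ])) stick-linked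
      stick++walk≡ : stick ++ walk h ≡ X ++ w ∷ Y ++ walk h
      stick++walk≡ = trans (cong (_++ walk h) stick≡) (++-assoc X (w ∷ Y) (walk h))
      wY-walk-linked : Linked (Adj G) (w ∷ Y ++ walk h)
      wY-walk-linked = Linked-++⁻ʳ X (subst (Linked (Adj G)) stick++walk≡ (stick++walk-linked h))
      S↭VL : X ++ w ∷ Y ++ walk h ↭ VL
      S↭VL = subst (_↭ VL) stick++walk≡ (++⁺ˡ stick (spans h))
      S : FlatLollipop
      S = record
        { stick        = X
        ; root         = w
        ; loop         = Y ++ walk h
        ; distinct     = Unique-resp-↭ (↭-sym S↭VL) VL-unique
        ; stick-linked = Linked-++-∷⁻ˡ X Xw-linked
        ; loop-linked  = Linked-∷ʳ {ys = w ∷ Y ++ s} wY-walk-linked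
                           (trans (cong (λ ws → w ∷ Y ++ ws) ends) (cong (w ∷_) (sym (++-assoc Y s [ z ])))) z~w
        ; loop-long    = 2≤length-++-walk Y h
        }

    stick-start-nbr∈VL : ∀ {p ps q} → stick ∷ʳ c ≡ p ∷ ps → Adj G p q → q ∈ VL
    stick-start-nbr∈VL {q = q} P≡ p~q with q ∈? VL
    ... | yes q∈VL = q∈VL
    ... | no  q∉VL = ⊥-elim (no-extension S ↭-refl)
      where
      S : FlatLollipop
      S = record
        { stick        = q ∷ stick
        ; root         = c
        ; loop         = Ctl L
        ; distinct     = All.¬Any⇒All¬ VL q∉VL ∷ VL-unique
        ; stick-linked = subst (λ ws → Linked (Adj G) (q ∷ ws)) (sym P≡) (Adj-sym p~q ∷ subst (Linked (Adj G)) P≡ stick-linked)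
        ; loop-linked  = cycle-linked
        ; loop-long    = s≤s⁻¹ C-long
        }

    rotate : ∀ h {z w f} → EndsAt h z → Adj G z w → (w , f) ∈ consecPairs (walk h) →
             Σ HamPath λ h′ → EndsAt h′ f × (w ≢ c → take 2 (walk h′) ≡ take 2 (walk h))
    rotate h {z} {w} {f} (s , ends) z~w wf∈ with ∈-consecPairs⁻ (walk h) wf∈
    ... | A , B , walk≡ = h′ , (A ++ w ∷ reverse B , ends′) , keeps-second
      where
      segment : ∃ λ B₀ → f ∷ B ≡ B₀ ∷ʳ z
      segment = ∷-suffix-∷ʳ (A ∷ʳ w) (trans (++-assoc A [ w ] (f ∷ B)) (trans (sym walk≡) ends))
      B₀ : List (Fin n)
      B₀ = proj₁ segment
      walk′ : List (Fin n)
      walk′ = A ++ w ∷ reverse (f ∷ B)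
      linked′ : Linked (Adj G) walk′
      linked′ = subst (λ ws → Linked (Adj G) (A ++ w ∷ reverse ws)) (sym (proj₂ segment))
        (Linked-rotate Adj-sym A B₀
          (subst (Linked (Adj G)) (trans walk≡ (cong (λ ws → A ++ w ∷ ws) (proj₂ segment))) (linked h))
          (Adj-sym z~w))
      walk′↭ : walk′ ↭ walk h
      walk′↭ = subst (walk′ ↭_) (sym walk≡) (++⁺ˡ A (↭-prep w (↭-reverse (f ∷ B))))
      h′ : HamPath
      h′ = record
        { walk   = walk′
        ; starts = trans (take-++-∷ A 0 z≤n) (trans (cong (take 1) (sym walk≡)) (starts h))
        ; spans  = ↭-trans walk′↭ (spans h)
        ; linked = linked′
        }
      ends′ : walk′ ≡ (A ++ w ∷ reverse B) ∷ʳ f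
      ends′ = trans (cong (λ ws → A ++ w ∷ ws) (unfold-reverse f B)) (sym (++-assoc A (w ∷ reverse B) [ f ]))
      keeps-second : w ≢ c → take 2 walk′ ≡ take 2 (walk h)
      keeps-second w≢c = trans (take-2-++-∷ A (trans (cong (take 1) (sym walk≡)) (starts h)) w≢c) (cong (take 2) (sym walk≡))

    -- The first vertex x of a Hamiltonian path of VL sees a later vertex q: the path up to q closes into a cycle, and the
    -- rest of the path, reversed from its end z, becomes a stick that can be extended by a neighbour w of z.
    reroute : ∀ {x x₂} X {q Y z w} → x ∷ x₂ ∷ X ++ q ∷ Y ↭ VL → Linked (Adj G) (x ∷ x₂ ∷ X ++ q ∷ Y) →
              (∃ λ s → x ∷ x₂ ∷ X ++ q ∷ Y ≡ s ∷ʳ z) → Adj G x q → Adj G z w → w ∉ VL → ⊥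
    reroute {x} {x₂} X {q} {Y} {z} {w} Q↭VL Q-linked (s , ends) x~q z~w w∉VL = no-extension S S↭
      where
      tail-ends : ∃ λ Y′ → q ∷ Y ≡ Y′ ∷ʳ z
      tail-ends = ∷-suffix-∷ʳ (x ∷ x₂ ∷ X) ends
      S↭ : w ∷ reverse Y ++ q ∷ x ∷ x₂ ∷ X ↭ w ∷ VL
      S↭ = ↭-prep w (↭-trans (↭-trans (++⁺ʳ (q ∷ x ∷ x₂ ∷ X) (↭-reverse Y))
                                       (↭-trans (++-comm Y (q ∷ x ∷ x₂ ∷ X)) (↭-sym (shift q (x ∷ x₂ ∷ X) Y))))
                             Q↭VL)
      reversed-tail : Linked (Adj G) (w ∷ reverse (q ∷ Y))
      reversed-tail = subst (λ ys → Linked (Adj G) (w ∷ reverse ys)) (sym (proj₂ tail-ends))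
        (Linked-∷-reverse Adj-sym (proj₁ tail-ends)
          (subst (Linked (Adj G)) (proj₂ tail-ends) (Linked-++⁻ʳ (x ∷ x₂ ∷ X) Q-linked))
          (Adj-sym z~w))
      S : FlatLollipop
      S = record
        { stick        = w ∷ reverse Y
        ; root         = q
        ; loop         = x ∷ x₂ ∷ X
        ; distinct     = Unique-resp-↭ (↭-sym S↭) (All.¬Any⇒All¬ VL w∉VL ∷ VL-unique)
        ; stick-linked = subst (λ ys → Linked (Adj G) (w ∷ ys)) (unfold-reverse q Y) reversed-tail
        ; loop-linked  = Adj-sym x~q ∷ Linked-++-∷⁻ˡ (x ∷ x₂ ∷ X) Q-linked
        ; loop-long    = s≤s (s≤s z≤n)
        }

    module MinDegree (k : ℕ) (2≤k : 2 ≤ k) (δ : MinDegreeAtLeast G k) where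

      hamiltonian-end-nbr∈VL : ∀ {p p₂ Q z w} → p ∷ p₂ ∷ Q ↭ VL → Linked (Adj G) (p ∷ p₂ ∷ Q) →
        (∃ λ s → p ∷ p₂ ∷ Q ≡ s ∷ʳ z) → (∀ {q} → Adj G p q → q ∈ VL) → Adj G z w → w ∈ VL
      hamiltonian-end-nbr∈VL {p} {p₂} {Q} {z} {w} Q↭VL Q-linked ends p-closed z~w with w ∈? VL
      ... | yes w∈VL = w∈VL
      ... | no  w∉VL with δ p
      ... | ws , ws! , k≤|ws| , p~ws with other-than _≟_ ws! (≤-trans 2≤k k≤|ws|) p₂
      ... | q , q∈ws , q≢p₂ with ∈-∃++ (∈-resp-↭ (↭-sym Q↭VL) (p-closed (All.lookup p~ws q∈ws)))
      ... | X , Y , Q≡ = ⊥-elim (split X Q≡)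
        where
        p~q : Adj G p q
        p~q = All.lookup p~ws q∈ws
        split : ∀ X {Y} → p ∷ p₂ ∷ Q ≡ X ++ q ∷ Y → ⊥
        split []           Q≡ = irrefl G (subst (Adj G p) (sym (∷-injectiveˡ Q≡)) p~q)
        split (_ ∷ [])     Q≡ = q≢p₂ (sym (∷-injectiveˡ (∷-injectiveʳ Q≡)))
        split (_ ∷ _ ∷ X′) Q≡ = reroute X′ (subst (_↭ VL) Q≡ Q↭VL) (subst (Linked (Adj G)) Q≡ Q-linked)
          (Prod.map₂ (trans (sym Q≡)) ends) (subst (λ v → Adj G v q) (∷-injectiveˡ Q≡) p~q) z~w w∉VL

      endpoint-nbr∈C : ∀ h {z w} → EndsAt h z → Adj G z w → w ∈ C
      endpoint-nbr∈C h {z} {w} (s , ends) z~w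
        with ∷∷-view (2≤length-++-walk stick h)
      ... | p , p₂ , Q , Q≡
        with ∈-++⁻ stick (hamiltonian-end-nbr∈VL
               (subst (_↭ VL) Q≡ (++⁺ˡ stick (spans h)))
               (subst (Linked (Adj G)) Q≡ (stick++walk-linked h))
               (stick ++ s , trans (sym Q≡) (trans (cong (stick ++_) ends) (sym (++-assoc stick s [ z ]))))
               (stick-start-nbr∈VL (proj₂ (stick++walk-starts h Q≡)))
               z~w)
      ... | inj₁ w∈stick = ⊥-elim (endpoint-nbr∉stick h (s , ends) z~w w∈stick)
      ... | inj₂ w∈C     = w∈C

      Good : Fin n → Set
      Good v = v ∈ C × AtLeastNbrsIn G k v C

      endpoint-good : ∀ {z} → Endpoint z → Good z
      endpoint-good {z} (h , s , ends) with δ z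
      ... | ws , ws! , k≤|ws| , z~ws =
        ∈-resp-↭ (spans h) (subst (z ∈_) (sym ends) (∈-++⁺ʳ s (here refl))) ,
        ws , ws! , k≤|ws| , All.map (λ z~w → endpoint-nbr∈C h (s , ends) z~w , z~w) z~ws

      Rotated : HamPath → List (Fin n) → Fin n → Set
      Rotated h W f = ∃ λ w → w ∈ W × (w , f) ∈ consecPairs (walk h)
                    × Σ HamPath λ h′ → EndsAt h′ f × (w ≢ c → take 2 (walk h′) ≡ take 2 (walk h))

      rotated-good : ∀ {h W f} → Rotated h W f → Good f
      rotated-good (_ , _ , _ , h′ , ends′ , _) = endpoint-good (h′ , ends′)

      end-nbr-successor : ∀ h {z w} → EndsAt h z → Adj G z w → ∃ λ f → (w , f) ∈ consecPairs (walk h)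
      end-nbr-successor h {z} {w} (s , ends) z~w = subst (λ ws → ∃ λ f → (w , f) ∈ consecPairs ws) (sym ends)
        (∈-consecPairs⁺ s (subst (w ∈_) ends (∈-resp-↭ (↭-sym (spans h)) (endpoint-nbr∈C h (s , ends) z~w)))
                          (λ { refl → irrefl G z~w }))

      rotations : ∀ h {z} → EndsAt h z → ∀ {W} → Unique W → All (Adj G z) W →
                  ∃ λ F → Unique F × length F ≡ length W × All (Rotated h W) F
      rotations h ends W! z~W
        with F , F! , |F|≡ , F-succ ← injective-image (λ w f → (w , f) ∈ consecPairs (walk h)) W!
                                        (end-nbr-successor h ends ∘ All.lookup z~W) (λ _ _ → predecessor-unique h)
        = F , F! , |F|≡ , All.map (λ (w , w∈W , wf) → w , w∈W , wf , rotate h ends (All.lookup z~W w∈W) wf) F-succ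

      GoodVertices : ℕ → Set
      GoodVertices m = ∃ λ vs → Unique vs × m ≤ length vs × All Good vs

      one-more : ∀ {vs x} → Unique vs → k ≤ length vs → All Good vs → Good x → x ∉ vs → GoodVertices (k + 1)
      one-more {vs} {x} vs! k≤|vs| vs-good x-good x∉vs =
        x ∷ vs , All.¬Any⇒All¬ vs x∉vs ∷ vs! , subst (_≤ suc (length vs)) (+-comm 1 k) (s≤s k≤|vs|) , x-good ∷ vs-good

      -- If c is not among the chosen neighbours of e, every rotation keeps the second vertex r of h. Either the given
      -- end d is a new good vertex, or d is reached by such a rotation, and rotating that path at c makes r an end.
      non-adjacent-end : ∀ {d} → Endpoint d → Adj G d c → ∀ h {e} → EndsAt h e → Adj G e c ⊎ GoodVertices (k + 1)
      non-adjacent-end {d} d-end d~c h {e} e-ends with δ e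
      ... | W , W! , k≤|W| , e~W with c ∈? W
      ... | yes c∈W = inj₁ (All.lookup e~W c∈W)
      ... | no  c∉W with rotations h e-ends W! e~W
      ... | F , F! , |F|≡ , F-rot = inj₂ (extend (d ∈? F))
        where
        extend-by : ∀ {x} → Good x → x ∉ F → GoodVertices (k + 1)
        extend-by = one-more F! (subst (k ≤_) (sym |F|≡) k≤|W|) (All.map (rotated-good {h} {W}) F-rot)
        extend : Dec (d ∈ F) → GoodVertices (k + 1)
        extend (no d∉F) = extend-by (endpoint-good d-end) d∉F
        extend (yes d∈F) with w , w∈W , _ , h′ , d-ends′ , same-second ← All.lookup F-rot d∈F
                         with r , t , walk≡ ← walk≡c∷r∷ h
                         with h″ , r-ends , _ ← rotate h′ d-ends′ d~c
                                                  (take-2≡⇒∈consecPairs (trans (same-second (λ { refl → c∉W w∈W })) (cong (take 2) walk≡)))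
          = extend-by (endpoint-good (h″ , r-ends)) r∉F
          where
          r∉F : r ∉ F
          r∉F r∈F with w′ , w′∈W , w′r , _ ← All.lookup F-rot r∈F =
            c∉W (subst (_∈ W) (predecessor-unique h w′r (subst (_ ∈_) (cong consecPairs (sym walk≡)) (here refl))) w′∈W)

      cycle-path : HamPath
      cycle-path = record { walk = C ; starts = refl ; spans = ↭-refl ; linked = Linked-++⁻ˡ C cycle-linked }

      cycle-path-end : ∃ λ z₀ → EndsAt cycle-path z₀ × Adj G z₀ c
      cycle-path-end with s₀ , z₀ , C≡ ← ∷-initLast c (Ctl L) =
        z₀ , (s₀ , C≡) , Linked-∷ʳ⁻ s₀ (subst (λ ws → Linked (Adj G) (ws ∷ʳ c)) C≡ cycle-linked)

      k+1-good : GoodVertices (k + 1)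
      k+1-good with z₀ , z₀-ends , z₀~c ← cycle-path-end
               with W , W! , k≤|W| , z₀~W ← δ z₀
               with F , F! , |F|≡ , F-rot ← rotations cycle-path z₀-ends W! z₀~W
               with All-⊎ʳ (All.map (λ (_ , _ , _ , h′ , ends′ , _) → non-adjacent-end (cycle-path , z₀-ends) z₀~c h′ ends′) F-rot)
      ... | inj₂ k+1 = k+1
      ... | inj₁ F~c = one-more F! k≤|F| F-good c-good c∉F
        where
        k≤|F| : k ≤ length F
        k≤|F| = subst (k ≤_) (sym |F|≡) k≤|W|
        F-good : All Good F
        F-good = All.map (rotated-good {cycle-path} {W}) F-rot
        c-good : Good c
        c-good = here refl , F , F! , k≤|F| , All.zipWith (λ (f-good , f~c) → proj₁ f-good , Adj-sym f~c) (F-good , F~c)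
        c∉F : c ∉ F
        c∉F c∈F with _ , _ , wc , _ ← All.lookup F-rot c∈F = successor≢c cycle-path wc refl

  module Chords (L : Lollipop G) where

    private
      c = c₁ L
      C = Cverts L

    -- A chord recorded in either orientation; IsChord fixes u < v.
    OrderedChord : Fin n × Fin n → Set
    OrderedChord (u , v) = u ∈ C × v ∈ C × Adj G u v × ¬ CycleEdge c (Ctl L) u v

    chord-nbrs : ∀ {k v} → v ∈ C → AtLeastNbrsIn G k v C →
                 ∃ λ N → Unique N × k ∸ 2 ≤ length N × All (λ w → OrderedChord (v , w)) N
    chord-nbrs {k} {v} v∈C (ws , ws! , k≤|ws| , ws∈C) =
      N , Unique.filter⁺ (∁? back?) N₁! ,
      ∸-monoˡ-≤ 2 (≤-trans k≤|ws| (≤-trans |ws|≤ (s≤s |N₁|≤))) , All.tabulate chord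
      where
      open import Data.List.Membership.DecPropositional (≡-dec _≟_ _≟_) using () renaming (_∈?_ to _∈ₚ?_)
      cyc : List (Fin n × Fin n)
      cyc = consecPairs (C ∷ʳ c)
      forth? : Decidable (λ w → (v , w) ∈ cyc)
      forth? w = (v , w) ∈ₚ? cyc
      back? : Decidable (λ w → (w , v) ∈ cyc)
      back? w = (w , v) ∈ₚ? cyc
      N₁ N : List (Fin n)
      N₁ = filter (∁? forth?) ws
      N  = filter (∁? back?) N₁
      N₁! : Unique N₁
      N₁! = Unique.filter⁺ (∁? forth?) ws!
      |ws|≤ : length ws ≤ suc (length N₁)
      |ws|≤ = length≤1+length-filter-∁ forth? ws! (consecPairs-functionalʳ C (proj₁ (proj₂ (cycC L))))
      |N₁|≤ : length N₁ ≤ suc (length N)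
      |N₁|≤ = length≤1+length-filter-∁ back? N₁!
                (consecPairs-functionalˡ c (Ctl L ∷ʳ c) (Unique-resp-↭ (∷↭∷ʳ c (Ctl L)) (proj₁ (proj₂ (cycC L)))))
      chord : ∀ {w} → w ∈ N → OrderedChord (v , w)
      chord w∈N with w∈N₁ , not-back ← ∈-filter⁻ (∁? back?) w∈N with w∈ws , not-forth ← ∈-filter⁻ (∁? forth?) w∈N₁
        = v∈C , proj₁ (All.lookup ws∈C w∈ws) , proj₂ (All.lookup ws∈C w∈ws) , [ not-forth , not-back ]′

    ordered-chords : ∀ {k vs} → Unique vs → All (λ v → v ∈ C × AtLeastNbrsIn G k v C) vs →
                     ∃ λ O → Unique O × length vs * (k ∸ 2) ≤ length O × All OrderedChord O × All ((_∈ vs) ∘ proj₁) O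
    ordered-chords []          []                    = [] , [] , z≤n , [] , []
    ordered-chords {k} {v ∷ vs} (v∉vs ∷ vs!) ((v∈C , v-nbrs) ∷ good)
      with N , N! , |N|≥ , N-chords ← chord-nbrs v∈C v-nbrs
         | O , O! , |O|≥ , O-chords , O-from ← ordered-chords vs! good
      = map (v ,_) N ++ O
      , Unique.++⁺ (Unique.map⁺ (cong proj₂) N!) O! disjoint
      , subst ((k ∸ 2) + length vs * (k ∸ 2) ≤_)
          (sym (trans (length-++ (map (v ,_) N)) (cong (_+ length O) (length-map (v ,_) N))))
          (+-mono-≤ |N|≥ |O|≥)
      , All.++⁺ (All.map⁺ N-chords) O-chords
      , All.++⁺ (All.map⁺ (All.tabulate λ _ → here refl)) (All.map there O-from)
      where
      disjoint : Disjoint (map (v ,_) N) O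
      disjoint (p∈ , p∈O) with _ , _ , refl ← ∈-map⁻ (v ,_) p∈ = All.lookup v∉vs (All.lookup O-from p∈O) refl

    orient : ∀ {O} → Unique O → All OrderedChord O → ∃ λ chs → Unique chs × length O ≤ 2 * length chs × All (IsChord L) chs
    orient {O} O! O-chords = [ use-down , use-up ]′ (≤-total (length up) (length down))
      where
      ascending? : Decidable (λ (p : Fin n × Fin n) → proj₁ p <ᶠ proj₂ p)
      ascending? (u , v) = u <ᶠ? v
      up down : List (Fin n × Fin n)
      up   = filter ascending? O
      down = filter (∁? ascending?) O
      bound : ∀ {m} → length up ≤ m → length down ≤ m → length O ≤ 2 * m
      bound {m} up≤ down≤ =
        subst₂ _≤_ (length-filter+filter-∁ ascending? O) (cong (m +_) (sym (+-identityʳ m))) (+-mono-≤ up≤ down≤)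
      up-chord : ∀ {p} → p ∈ up → IsChord L p
      up-chord {u , v} p∈ with p∈O , u<v ← ∈-filter⁻ ascending? p∈ = u<v , All.lookup O-chords p∈O
      down-chord : ∀ {q} → q ∈ map swap down → IsChord L q
      down-chord q∈ with (u , v) , p∈ , refl ← ∈-map⁻ swap q∈ with p∈O , u≮v ← ∈-filter⁻ (∁? ascending?) p∈
                    with u∈C , v∈C , u~v , not-edge ← All.lookup O-chords p∈O
        = v<u , v∈C , u∈C , Adj-sym u~v , not-edge ∘ Data.Sum.swap
        where
        v<u : v <ᶠ u
        v<u with <-cmp u v
        ... | tri< u<v _ _ = ⊥-elim (u≮v u<v)
        ... | tri≈ _ refl _ = ⊥-elim (irrefl G u~v)
        ... | tri> _ _ v<u = v<u
      use-up : length down ≤ length up → ∃ λ chs → Unique chs × length O ≤ 2 * length chs × All (IsChord L) chs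
      use-up down≤up = up , Unique.filter⁺ ascending? O! , bound ≤-refl down≤up , All.tabulate up-chord
      use-down : length up ≤ length down → ∃ λ chs → Unique chs × length O ≤ 2 * length chs × All (IsChord L) chs
      use-down up≤down = map swap down , Unique.map⁺ (cong swap) (Unique.filter⁺ (∁? ascending?) O!) ,
        subst (λ m → length O ≤ 2 * m) (sym (length-map swap down)) (bound up≤down ≤-refl) , All.tabulate down-chord

    chords : ∀ {k vs} → Unique vs → All (λ v → v ∈ C × AtLeastNbrsIn G k v C) vs →
             ∃ λ chs → Unique chs × length vs * (k ∸ 2) ≤ 2 * length chs × All (IsChord L) chs
    chords vs! good with O , O! , |O|≥ , O-chords , _ ← ordered-chords vs! good
                    with chs , chs! , |O|≤ , chs-chords ← orient O! O-chords
      = chs , chs! , ≤-trans |O|≥ |O|≤ , chs-chords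

lemma5 : ∀ {n : ℕ} (G : Graph n) (k : ℕ) → 2 ≤ k → MinDegreeAtLeast G k
    → (L : Lollipop G) → Optimal L
    → (∃ λ (vs : List (Fin n)) → Unique vs × k + 1 ≤ length vs
         × All (λ v → v ∈ Cverts L × AtLeastNbrsIn G k v (Cverts L)) vs)
      × (∃ λ (chs : List (Fin n × Fin n)) → Unique chs
         × (k + 1) * (k ∸ 2) ≤ 2 * length chs × All (IsChord L) chs)
lemma5 G k 2≤k δ L opt
  with vs , vs! , k+1≤|vs| , good ← Lollipops.OptimalLollipop.MinDegree.k+1-good G L opt k 2≤k δ
  with chs , chs! , |vs|[k-2]≤ , chords ← Lollipops.Chords.chords G L vs! good
  = (vs , vs! , k+1≤|vs| , good) , chs , chs! , ≤-trans (*-monoˡ-≤ (k ∸ 2) k+1≤|vs|) |vs|[k-2]≤ , chords
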